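{- Let $\sigma_1\in BP_1(n)$ have $k$ cycles and let $\sigma_2=\beta(\sigma_1)$. Then the set of weak exceedances of $\sigma_2$ is exactly $\{1,2,\ldots,k\}$.
   Context: $\mathfrak{S}_n$ is the symmetric group on $[n]$; a cycle written as a word $(a_1a_2\cdots a_m)$ denotes $a_1\mapsto a_2\mapsto\cdots\mapsto a_m\mapsto a_1$. $BP_1(n)$ (Bell permutations of the first kind, Poneti–Vajnovszki) is the set of permutations obtained from a set partition of $[n]$ by writing each block in decreasing order and making it a cycle; equivalently, permutations each of whose cycles, written starting from its maximum, is decreasing. A weak exceedance of $\sigma$ is a position $i$ with $\sigma(i)\ge i$. The map $\beta$: write $\sigma_1=C_1C_2\cdots C_k$ with cycles ordered by increasing minima, each $C_i$ written as the word of its elements in decreasing order (starting at its maximum). For $i=k,k-1,\ldots,2$: if $i$ does not belong to (the current word of) $C_i$, remove the current word of $C_i$ and insert it, as a contiguous block, immediately after the letter $i$ in the cycle word currently containing $i$. The permutation represented by the resulting cycle words is $\beta(\sigma_1)$. (E.g. $(9721)(653)(84)\to(9721)(65384)\to(972653841)$.) -}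

module Defs where

open import Data.Nat using (ℕ; zero; suc; _<_; _>_; _⊓_; _≟_)
open import Data.List using (List; []; _∷_; foldr; map; concat; upTo; length)
open import Data.List.Relation.Unary.All using (All)
open import Data.List.Relation.Unary.Linked using (Linked)
open import Data.List.Relation.Binary.Permutation.Propositional using (_↭_)
open import Data.List.Membership.DecPropositional _≟_ using (_∈?_)
open import Data.Maybe using (Maybe; just; nothing)
open import Data.Product using (_×_)
open import Relation.Binary.PropositionalEquality using (_≢_)
open import Relation.Nullary using (yes; no)

-- Elements of [n] are the naturals 1,…,n.
-- A permutation is given by a list of cycle words: the word (a₁ a₂ … aₘ)
-- maps a₁ ↦ a₂ ↦ … ↦ aₘ ↦ a₁.

succIn : ℕ → ℕ → List ℕ → ℕ → Maybe ℕ
-- succIn first a rest x : a is the current letter, rest the letters after it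
succIn first a [] x with a ≟ x
... | yes _ = just first
... | no _ = nothing
succIn first a (b ∷ rest) x with a ≟ x
... | yes _ = just b
... | no _ = succIn first b rest x

cycApply : List ℕ → ℕ → Maybe ℕ
cycApply [] x = nothing
cycApply (a ∷ w) x = succIn a a w x

applyWords : List (List ℕ) → ℕ → ℕ
applyWords [] x = x
applyWords (w ∷ ws) x with cycApply w x
... | just y = y
... | nothing = applyWords ws x

minL : List ℕ → ℕ
minL [] = 0
minL (x ∷ xs) = foldr _⊓_ x xs

-- C is the canonical cycle decomposition of a permutation in BP₁(n):
-- every cycle is a nonempty word written in decreasing order (from its
-- maximum), the cycles are ordered by increasing minima, and together the
-- words contain each of 1,…,n exactly once (set partition of [n]).
IsBP1Words : ℕ → List (List ℕ) → Set
IsBP1Words n C =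
  All (λ w → (w ≢ []) × Linked _>_ w) C
  × Linked (λ u v → minL u < minL v) C
  × (concat C ↭ map suc (upTo n))

lookupL : List (List ℕ) → ℕ → List ℕ
lookupL [] _ = []
lookupL (w ∷ ws) zero = w
lookupL (w ∷ ws) (suc j) = lookupL ws j

setL : List (List ℕ) → ℕ → List ℕ → List (List ℕ)
setL [] _ _ = []
setL (w ∷ ws) zero v = v ∷ ws
setL (w ∷ ws) (suc j) v = w ∷ setL ws j v

insertAfter : ℕ → List ℕ → List ℕ → List ℕ
insertAfter a b [] = []
insertAfter a b (x ∷ xs) with x ≟ a
... | yes _ = x ∷ foldr _∷_ xs b
... | no _ = x ∷ insertAfter a b xs

-- one step of β for index i (slot i is at 0-based position i-1);
-- a removed cycle leaves an empty slot behind (empty words represent nothing)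
βstep : ℕ → List (List ℕ) → List (List ℕ)
βstep zero ws = ws
βstep (suc j) ws with suc j ∈? lookupL ws j
... | yes _ = ws
... | no _ = map (insertAfter (suc j) (lookupL ws j)) (setL ws j [])

βloop : ℕ → List (List ℕ) → List (List ℕ)
βloop zero ws = ws
βloop (suc zero) ws = ws
βloop (suc (suc j)) ws = βloop (suc j) (βstep (suc (suc j)) ws)

β : List (List ℕ) → List (List ℕ)
β C = βloop (length C) C

module Submission where

-- β performs the steps i = k, k-1, …, 2, and the proof is an invariant of this loop. Slot q
-- (0-based) only holds letters ≥ q+1, and the last letters of the live slots 0, …, i-1 are
-- either > k or ≤ i. Only the images of these last letters can still change; every other
-- letter has its final status: letters ≤ i are strict descents, and letters > i are weak
-- exceedances exactly when they are ≤ k. At step i, if i lies in slot i-1 it is the least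
-- letter, hence the last one, of that slot and maps to its top letter ≥ i. Otherwise moving
-- the word W of slot i-1 behind i gives i ↦ max W > i, while the last letter x of W, which
-- is > k, inherits the old image of i, a descent below i < x. When i = 1 only slot 0 is
-- live; it ends with 1, which maps to its top letter.

open import Defs
open import Data.Nat using (ℕ; zero; suc; _+_; _⊓_; _≤_; _<_; _>_; _≤?_; _≟_; z≤n; s≤s)
open import Data.Nat.Properties
open import Data.List using (List; []; _∷_; _++_; length; map; concat; upTo; foldr)
open import Data.List.Properties using (++-identityʳ; ++-is-foldr)
open import Data.List.Membership.Propositional using (_∈_; _∉_)
open import Data.List.Membership.Propositional.Properties
  using (∈-++⁺ˡ; ∈-++⁺ʳ; ∈-++⁻; ∈-∃++; ∈-map⁺; ∈-map⁻; ∈-upTo⁺; ∈-upTo⁻)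
open import Data.List.Membership.DecPropositional _≟_ using (_∈?_)
open import Data.List.Relation.Unary.Any using (here; there)
open import Data.List.Relation.Unary.All as All using (All; []; _∷_)
import Data.List.Relation.Unary.All.Properties as Allₚ
open import Data.List.Relation.Unary.Linked using (Linked; [-]; _∷_)
open import Data.List.Relation.Unary.Unique.Propositional using (Unique; []; _∷_)
open import Data.List.Relation.Unary.Unique.Propositional.Properties
  using (upTo⁺; Unique[x∷xs]⇒x∉xs)
  renaming (map⁺ to Unique-map⁺)
open import Data.List.Relation.Binary.Permutation.Propositional
  using (_↭_; ↭-refl; ↭-sym; ↭-trans; prep; ↭⇒↭ₛ)
import Data.List.Relation.Binary.Permutation.Propositional.Properties as ↭
import Data.List.Relation.Binary.Permutation.Setoid.Properties as ↭ₛ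
open import Data.Maybe using (just; nothing)
open import Data.Product using (∃; ∃₂; _×_; _,_; proj₁; proj₂)
open import Data.Sum using (_⊎_; inj₁; inj₂)
open import Data.Empty using (⊥-elim)
open import Relation.Nullary using (¬_; yes; no)
open import Relation.Binary.PropositionalEquality
open import Function.Bundles using (_⇔_; mk⇔)

data Adjacent : List ℕ → ℕ → ℕ → Set where
  adj-here  : ∀ {y z w} → Adjacent (y ∷ z ∷ w) y z
  adj-there : ∀ {a w y z} → Adjacent w y z → Adjacent (a ∷ w) y z

data Last : List ℕ → ℕ → Set where
  last-here  : ∀ {x} → Last (x ∷ []) x
  last-there : ∀ {a w x} → Last w x → Last (a ∷ w) x

CyclicSucc : List ℕ → ℕ → ℕ → Set
CyclicSucc w y z = Adjacent w y z ⊎ (Last w y × ∃ λ t → w ≡ z ∷ t)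

Adjacent-∈ˡ : ∀ {w y z} → Adjacent w y z → y ∈ w
Adjacent-∈ˡ adj-here      = here refl
Adjacent-∈ˡ (adj-there a) = there (Adjacent-∈ˡ a)

Adjacent-∈ʳ : ∀ {w y z} → Adjacent w y z → z ∈ w
Adjacent-∈ʳ adj-here      = there (here refl)
Adjacent-∈ʳ (adj-there a) = there (Adjacent-∈ʳ a)

Last-∈ : ∀ {w y} → Last w y → y ∈ w
Last-∈ last-here      = here refl
Last-∈ (last-there l) = there (Last-∈ l)

CyclicSucc-∈ : ∀ {w y z} → CyclicSucc w y z → y ∈ w
CyclicSucc-∈ (inj₁ a)       = Adjacent-∈ˡ a
CyclicSucc-∈ (inj₂ (l , _)) = Last-∈ l

Last-unique : ∀ {w a b} → Last w a → Last w b → a ≡ b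
Last-unique last-here      last-here      = refl
Last-unique (last-there p) (last-there q) = Last-unique p q

Last-exists : ∀ a w → ∃ (Last (a ∷ w))
Last-exists a []      = a , last-here
Last-exists a (b ∷ w) = let x , l = Last-exists b w in x , last-there l

∈⇒Last⊎Adjacent : ∀ {w y} → y ∈ w → Last w y ⊎ ∃ (Adjacent w y)
∈⇒Last⊎Adjacent {_ ∷ []}    (here refl) = inj₁ last-here
∈⇒Last⊎Adjacent {_ ∷ b ∷ _} (here refl) = inj₂ (b , adj-here)
∈⇒Last⊎Adjacent {_ ∷ _ ∷ _} (there p) with ∈⇒Last⊎Adjacent p
... | inj₁ l       = inj₁ (last-there l)
... | inj₂ (z , a) = inj₂ (z , adj-there a)

∈⇒CyclicSucc : ∀ {w y} → y ∈ w → ∃ (CyclicSucc w y)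
∈⇒CyclicSucc {a ∷ w} p with ∈⇒Last⊎Adjacent p
... | inj₁ l       = a , inj₂ (l , w , refl)
... | inj₂ (z , q) = z , inj₁ q

Adjacent⇒¬Last : ∀ {w y z} → Unique w → Adjacent w y z → ¬ Last w y
Adjacent⇒¬Last (y≢ ∷ _) adj-here      (last-there l) = All.lookup y≢ (Last-∈ l) refl
Adjacent⇒¬Last (_ ∷ u)  (adj-there a) (last-there l) = Adjacent⇒¬Last u a l

Adjacent-descending : ∀ {w y z} → Linked _>_ w → Adjacent w y z → z < y
Adjacent-descending (y>z ∷ _) adj-here      = y>z
Adjacent-descending (_ ∷ lk)  (adj-there a) = Adjacent-descending lk a

Last-minimal : ∀ {w l y} → Linked _>_ w → Last w l → y ∈ w → l ≤ y
Last-minimal [-]      last-here      (here refl) = ≤-refl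
Last-minimal (r ∷ lk) (last-there l) (here refl) = <⇒≤ (≤-<-trans (Last-minimal lk l (here refl)) r)
Last-minimal (_ ∷ lk) (last-there l) (there m)   = Last-minimal lk l m

Unique-++⁻ˡ : ∀ (xs : List ℕ) {ys} → Unique (xs ++ ys) → Unique xs
Unique-++⁻ˡ []       _        = []
Unique-++⁻ˡ (x ∷ xs) (x≢ ∷ u) = Allₚ.++⁻ˡ xs x≢ ∷ Unique-++⁻ˡ xs u

Unique-++⁻ʳ : ∀ (xs : List ℕ) {ys} → Unique (xs ++ ys) → Unique ys
Unique-++⁻ʳ []       u       = u
Unique-++⁻ʳ (x ∷ xs) (_ ∷ u) = Unique-++⁻ʳ xs u

Unique-++-disjoint : ∀ (xs : List ℕ) {ys y} → Unique (xs ++ ys) → y ∈ xs → y ∉ ys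
Unique-++-disjoint (x ∷ xs) (x≢ ∷ _) (here refl) y∈ys = All.lookup x≢ (∈-++⁺ʳ xs y∈ys) refl
Unique-++-disjoint (x ∷ xs) (_ ∷ u)  (there y∈xs)     = Unique-++-disjoint xs u y∈xs

Unique-resp-↭ : ∀ {xs ys : List ℕ} → xs ↭ ys → Unique xs → Unique ys
Unique-resp-↭ p = ↭ₛ.Unique-resp-↭ (setoid ℕ) (↭⇒↭ₛ p)

Unique-range : ∀ n → Unique (map suc (upTo n))
Unique-range n = Unique-map⁺ suc-injective (upTo⁺ n)

∈-range⁻ : ∀ {n y} → y ∈ map suc (upTo n) → 1 ≤ y × y ≤ n
∈-range⁻ m with ∈-map⁻ suc m
... | _ , z∈ , refl = s≤s z≤n , ∈-upTo⁻ z∈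

∈-range⁺ : ∀ {n y} → 1 ≤ y → y ≤ n → y ∈ map suc (upTo n)
∈-range⁺ {y = suc _} _ y≤n = ∈-map⁺ suc (∈-upTo⁺ y≤n)

lookup-∈-concat : ∀ ws q {y} → y ∈ lookupL ws q → y ∈ concat ws
lookup-∈-concat (w ∷ ws) zero    p = ∈-++⁺ˡ p
lookup-∈-concat (w ∷ ws) (suc q) p = ∈-++⁺ʳ w (lookup-∈-concat ws q p)

∈-concat⇒lookup : ∀ ws {y} → y ∈ concat ws → ∃ λ q → y ∈ lookupL ws q
∈-concat⇒lookup (w ∷ ws) p with ∈-++⁻ w p
... | inj₁ y∈w  = zero , y∈w
... | inj₂ y∈ws = let q , y∈ = ∈-concat⇒lookup ws y∈ws in suc q , y∈

lookup-<-length : ∀ ws q {y} → y ∈ lookupL ws q → q < length ws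
lookup-<-length (w ∷ ws) zero    _ = s≤s z≤n
lookup-<-length (w ∷ ws) (suc q) p = s≤s (lookup-<-length ws q p)

All-lookupL : ∀ {P : List ℕ → Set} ws q → All P ws → q < length ws → P (lookupL ws q)
All-lookupL (w ∷ ws) zero    (pw ∷ _)   _        = pw
All-lookupL (w ∷ ws) (suc q) (_ ∷ pws) (s≤s q<) = All-lookupL ws q pws q<

lookup-unique : ∀ ws {q q' y} → Unique (concat ws) →
                y ∈ lookupL ws q → y ∈ lookupL ws q' → q ≡ q'
lookup-unique (w ∷ ws) {zero}  {zero}   u p p' = refl
lookup-unique (w ∷ ws) {zero}  {suc q'} u p p' = ⊥-elim (Unique-++-disjoint w u p (lookup-∈-concat ws q' p'))
lookup-unique (w ∷ ws) {suc q} {zero}   u p p' = ⊥-elim (Unique-++-disjoint w u p' (lookup-∈-concat ws q p))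
lookup-unique (w ∷ ws) {suc q} {suc q'} u p p' = cong suc (lookup-unique ws (Unique-++⁻ʳ w u) p p')

Unique-lookup : ∀ ws q → Unique (concat ws) → Unique (lookupL ws q)
Unique-lookup []       q       _ = []
Unique-lookup (w ∷ ws) zero    u = Unique-++⁻ˡ w u
Unique-lookup (w ∷ ws) (suc q) u = Unique-lookup ws q (Unique-++⁻ʳ w u)

succIn-∉ : ∀ f a w y → y ∉ a ∷ w → succIn f a w y ≡ nothing
succIn-∉ f a []      y y∉ with a ≟ y
... | yes refl = ⊥-elim (y∉ (here refl))
... | no _     = refl
succIn-∉ f a (b ∷ w) y y∉ with a ≟ y
... | yes refl = ⊥-elim (y∉ (here refl))
... | no _     = succIn-∉ f b w y (λ y∈ → y∉ (there y∈))

succIn-Adjacent : ∀ f a w {y z} → Unique (a ∷ w) → Adjacent (a ∷ w) y z → succIn f a w y ≡ just z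
succIn-Adjacent f a (b ∷ w) _ adj-here with a ≟ a
... | yes _  = refl
... | no a≢a = ⊥-elim (a≢a refl)
succIn-Adjacent f a (b ∷ w) {y} (a≢ ∷ u) (adj-there p) with a ≟ y
... | yes refl = ⊥-elim (All.lookup a≢ (Adjacent-∈ˡ p) refl)
... | no _     = succIn-Adjacent f b w u p

succIn-Last : ∀ f a w {y} → Unique (a ∷ w) → Last (a ∷ w) y → succIn f a w y ≡ just f
succIn-Last f a [] _ last-here with a ≟ a
... | yes _  = refl
... | no a≢a = ⊥-elim (a≢a refl)
succIn-Last f a (b ∷ w) {y} (a≢ ∷ u) (last-there p) with a ≟ y
... | yes refl = ⊥-elim (All.lookup a≢ (Last-∈ p) refl)
... | no _     = succIn-Last f b w u p

cycApply-CyclicSucc : ∀ {w y z} → Unique w → CyclicSucc w y z → cycApply w y ≡ just z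
cycApply-CyclicSucc {a ∷ w} u (inj₁ p)              = succIn-Adjacent a a w u p
cycApply-CyclicSucc {a ∷ w} u (inj₂ (p , _ , refl)) = succIn-Last a a w u p

cycApply-∉ : ∀ {w y} → y ∉ w → cycApply w y ≡ nothing
cycApply-∉ {[]}    _  = refl
cycApply-∉ {a ∷ w} y∉ = succIn-∉ a a w _ y∉

Successor : List (List ℕ) → ℕ → ℕ → Set
Successor ws y z = ∃ λ q → CyclicSucc (lookupL ws q) y z

applyWords-Successor : ∀ ws {y z} → Unique (concat ws) → Successor ws y z → applyWords ws y ≡ z
applyWords-Successor []       _ (_ , inj₁ ())
applyWords-Successor []       _ (_ , inj₂ (() , _))
applyWords-Successor (w ∷ ws) u (zero , c) rewrite cycApply-CyclicSucc (Unique-++⁻ˡ w u) c = refl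
applyWords-Successor (w ∷ ws) {y} u (suc q , c)
  rewrite cycApply-∉ {w} {y} (λ y∈w → Unique-++-disjoint w u y∈w (lookup-∈-concat ws q (CyclicSucc-∈ c)))
  = applyWords-Successor ws (Unique-++⁻ʳ w u) (q , c)

Successor-applyWords : ∀ ws {y} → Unique (concat ws) → y ∈ concat ws → Successor ws y (applyWords ws y)
Successor-applyWords ws u y∈ with ∈-concat⇒lookup ws y∈
... | q , y∈q with ∈⇒CyclicSucc y∈q
... | z , c rewrite applyWords-Successor ws u (q , c) = q , c

Adjacent-++ʳ : ∀ (pre : List ℕ) {w y z} → Adjacent w y z → Adjacent (pre ++ w) y z
Adjacent-++ʳ []        a = a
Adjacent-++ʳ (_ ∷ pre) a = adj-there (Adjacent-++ʳ pre a)

Adjacent-++ˡ : ∀ post {w y z} → Adjacent w y z → Adjacent (w ++ post) y z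
Adjacent-++ˡ post adj-here      = adj-here
Adjacent-++ˡ post (adj-there a) = adj-there (Adjacent-++ˡ post a)

Last-++ʳ : ∀ (pre : List ℕ) {w y} → Last w y → Last (pre ++ w) y
Last-++ʳ []        l = l
Last-++ʳ (_ ∷ pre) l = last-there (Last-++ʳ pre l)

Last-∷⁻ : ∀ {a w l} → Last (a ∷ w) l → Last w l ⊎ (w ≡ [] × l ≡ a)
Last-∷⁻ last-here      = inj₂ (refl , refl)
Last-∷⁻ (last-there l) = inj₁ l

Last-++⁻ : ∀ W {w l} → Last (W ++ w) l → Last w l ⊎ (w ≡ [] × Last W l)
Last-++⁻ []          l = inj₁ l
Last-++⁻ (a ∷ [])    {[]}    l              = inj₂ (refl , l)
Last-++⁻ (a ∷ [])    {_ ∷ _} (last-there l) = inj₁ l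
Last-++⁻ (a ∷ b ∷ W) (last-there l) with Last-++⁻ (b ∷ W) l
... | inj₁ l′        = inj₁ l′
... | inj₂ (e , l′)  = inj₂ (e , last-there l′)

Last-split : ∀ as {i w l} → Last (as ++ i ∷ w) l → Last w l ⊎ (w ≡ [] × l ≡ i)
Last-split as l with Last-++⁻ as l
... | inj₁ l′ = Last-∷⁻ l′
... | inj₂ (() , _)

Last⇒Adjacent-++ : ∀ {W x} s w → Last W x → Adjacent (W ++ s ∷ w) x s
Last⇒Adjacent-++ s w last-here      = adj-here
Last⇒Adjacent-++ s w (last-there l) = adj-there (Last⇒Adjacent-++ s w l)

Adjacent-insert : ∀ as {i bs W y z} → y ≢ i →
                  Adjacent (as ++ i ∷ bs) y z → Adjacent (as ++ i ∷ W ++ bs) y z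
Adjacent-insert []          y≢i adj-here              = ⊥-elim (y≢i refl)
Adjacent-insert [] {W = W}  y≢i (adj-there a)         = adj-there (Adjacent-++ʳ W a)
Adjacent-insert (_ ∷ [])    y≢i adj-here              = adj-here
Adjacent-insert (_ ∷ [])    y≢i (adj-there a)         = adj-there (Adjacent-insert [] y≢i a)
Adjacent-insert (_ ∷ _ ∷ _) y≢i adj-here              = adj-here
Adjacent-insert (_ ∷ b ∷ as) y≢i (adj-there a)        = adj-there (Adjacent-insert (b ∷ as) y≢i a)

Adjacent-after : ∀ as {i bs s} → i ∉ as → i ∉ bs → Adjacent (as ++ i ∷ bs) i s → ∃ λ bs′ → bs ≡ s ∷ bs′
Adjacent-after []           _    _    adj-here      = _ , refl
Adjacent-after []           _    i∉bs (adj-there a) = ⊥-elim (i∉bs (Adjacent-∈ˡ a))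
Adjacent-after (_ ∷ [])     i∉as _    adj-here      = ⊥-elim (i∉as (here refl))
Adjacent-after (_ ∷ [])     _    i∉bs (adj-there a) = Adjacent-after [] (λ ()) i∉bs a
Adjacent-after (_ ∷ b ∷ as) i∉as _    adj-here      = ⊥-elim (i∉as (here refl))
Adjacent-after (_ ∷ b ∷ as) i∉as i∉bs (adj-there a) = Adjacent-after (b ∷ as) (λ m → i∉as (there m)) i∉bs a

head-insert : ∀ (as : List ℕ) {i bs cs z t} → as ++ i ∷ bs ≡ z ∷ t → ∃ λ t′ → as ++ i ∷ cs ≡ z ∷ t′
head-insert []      refl = _ , refl
head-insert (_ ∷ _) refl = _ , refl

insertAfter-∉ : ∀ i W w → i ∉ w → insertAfter i W w ≡ w
insertAfter-∉ i W []      _  = refl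
insertAfter-∉ i W (x ∷ w) i∉ with x ≟ i
... | yes refl = ⊥-elim (i∉ (here refl))
... | no _     = cong (x ∷_) (insertAfter-∉ i W w (λ m → i∉ (there m)))

insertAfter-split : ∀ i W as bs → i ∉ as → insertAfter i W (as ++ i ∷ bs) ≡ as ++ i ∷ W ++ bs
insertAfter-split i W [] bs _ with i ≟ i
... | yes _  = cong (i ∷_) (sym (++-is-foldr W bs))
... | no i≢i = ⊥-elim (i≢i refl)
insertAfter-split i W (a ∷ as) bs i∉ with a ≟ i
... | yes refl = ⊥-elim (i∉ (here refl))
... | no _     = cong (a ∷_) (insertAfter-split i W as bs (λ m → i∉ (there m)))

insertAfter-∷ : ∀ i W a w → ∃ λ t → insertAfter i W (a ∷ w) ≡ a ∷ t
insertAfter-∷ i W a w with a ≟ i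
... | yes _ = _ , refl
... | no _  = _ , refl

map-insertAfter-∉ : ∀ i W ws → i ∉ concat ws → map (insertAfter i W) ws ≡ ws
map-insertAfter-∉ i W []       _  = refl
map-insertAfter-∉ i W (w ∷ ws) i∉ =
  cong₂ _∷_ (insertAfter-∉ i W w (λ m → i∉ (∈-++⁺ˡ m))) (map-insertAfter-∉ i W ws (λ m → i∉ (∈-++⁺ʳ w m)))

lookup-map : ∀ (f : List ℕ → List ℕ) ws q → f [] ≡ [] → lookupL (map f ws) q ≡ f (lookupL ws q)
lookup-map f []       q       f[] = sym f[]
lookup-map f (w ∷ ws) zero    _   = refl
lookup-map f (w ∷ ws) (suc q) f[] = lookup-map f ws q f[]

lookup-setL-≡ : ∀ ws q → lookupL (setL ws q []) q ≡ []
lookup-setL-≡ []       q       = refl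
lookup-setL-≡ (w ∷ ws) zero    = refl
lookup-setL-≡ (w ∷ ws) (suc q) = lookup-setL-≡ ws q

lookup-setL-≢ : ∀ ws q q′ v → q′ ≢ q → lookupL (setL ws q v) q′ ≡ lookupL ws q′
lookup-setL-≢ []       q       q′       v _  = refl
lookup-setL-≢ (w ∷ ws) zero    zero     v ne = ⊥-elim (ne refl)
lookup-setL-≢ (w ∷ ws) zero    (suc q′) v _  = refl
lookup-setL-≢ (w ∷ ws) (suc q) zero     v _  = refl
lookup-setL-≢ (w ∷ ws) (suc q) (suc q′) v ne = lookup-setL-≢ ws q q′ v (λ e → ne (cong suc e))

concat-setL-↭ : ∀ ws q → concat (setL ws q []) ++ lookupL ws q ↭ concat ws
concat-setL-↭ []       q       = ↭-refl
concat-setL-↭ (w ∷ ws) zero    = ↭.++-comm (concat ws) w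
concat-setL-↭ (w ∷ ws) (suc q) =
  ↭-trans (↭.++-assoc w (concat (setL ws q [])) (lookupL ws q)) (↭.++⁺ˡ w (concat-setL-↭ ws q))

insert-↭ : ∀ (as : List ℕ) i W bs → as ++ i ∷ W ++ bs ↭ (as ++ i ∷ bs) ++ W
insert-↭ []       i W bs = prep i (↭.++-comm W bs)
insert-↭ (a ∷ as) i W bs = prep a (insert-↭ as i W bs)

concat-map-insertAfter-↭ : ∀ i W ws → Unique (concat ws) → i ∈ concat ws →
                           concat (map (insertAfter i W) ws) ↭ concat ws ++ W
concat-map-insertAfter-↭ i W (w ∷ ws) u i∈ with ∈-++⁻ w i∈
... | inj₂ i∈ws rewrite insertAfter-∉ i W w (λ i∈w → Unique-++-disjoint w u i∈w i∈ws) =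
  ↭-trans (↭.++⁺ˡ w (concat-map-insertAfter-↭ i W ws (Unique-++⁻ʳ w u) i∈ws))
          (↭-sym (↭.++-assoc w (concat ws) W))
... | inj₁ i∈w with ∈-∃++ i∈w
... | as , bs , refl
  rewrite map-insertAfter-∉ i W ws (Unique-++-disjoint (as ++ i ∷ bs) u i∈w)
        | insertAfter-split i W as bs (λ m → Unique-++-disjoint as (Unique-++⁻ˡ (as ++ i ∷ bs) u) m (here refl))
  = ↭-trans (↭.++⁺ʳ (concat ws) (insert-↭ as i W bs))
            (↭-trans (↭.++-assoc (as ++ i ∷ bs) W (concat ws))
                     (↭-trans (↭.++⁺ˡ (as ++ i ∷ bs) (↭.++-comm W (concat ws)))
                              (↭-sym (↭.++-assoc (as ++ i ∷ bs) (concat ws) W))))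

-- One step of β: the word W in slot q₀ moves right after the letter i

module MoveBlock (ws : List (List ℕ)) (q₀ i : ℕ) (uniq : Unique (concat ws))
                 {b₀ : ℕ} {W₀ : List ℕ} (W≡ : lookupL ws q₀ ≡ b₀ ∷ W₀)
                 (i∉W : i ∉ b₀ ∷ W₀) (i∈ : i ∈ concat ws) where

  W : List ℕ
  W = b₀ ∷ W₀

  x : ℕ
  x = proj₁ (Last-exists b₀ W₀)

  W-ends-with-x : Last W x
  W-ends-with-x = proj₂ (Last-exists b₀ W₀)

  p : ℕ
  p = proj₁ (∈-concat⇒lookup ws i∈)

  i∈p : i ∈ lookupL ws p
  i∈p = proj₂ (∈-concat⇒lookup ws i∈)

  as bs : List ℕ
  as = proj₁ (∈-∃++ i∈p)
  bs = proj₁ (proj₂ (∈-∃++ i∈p))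

  p≡ : lookupL ws p ≡ as ++ i ∷ bs
  p≡ = proj₂ (proj₂ (∈-∃++ i∈p))

  Unique-p : Unique (as ++ i ∷ bs)
  Unique-p = subst Unique p≡ (Unique-lookup ws p uniq)

  i∉as : i ∉ as
  i∉as i∈as = Unique-++-disjoint as Unique-p i∈as (here refl)

  i∉bs : i ∉ bs
  i∉bs = Unique[x∷xs]⇒x∉xs (Unique-++⁻ʳ as Unique-p)

  p≢q₀ : p ≢ q₀
  p≢q₀ refl = i∉W (subst (i ∈_) W≡ i∈p)

  ws′ : List (List ℕ)
  ws′ = map (insertAfter i (lookupL ws q₀)) (setL ws q₀ [])

  lookup-ws′ : ∀ q → lookupL ws′ q ≡ insertAfter i W (lookupL (setL ws q₀ []) q)
  lookup-ws′ q rewrite W≡ = lookup-map (insertAfter i W) (setL ws q₀ []) q refl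

  lookup-target : lookupL ws′ p ≡ as ++ i ∷ W ++ bs
  lookup-target = begin
    lookupL ws′ p                                   ≡⟨ lookup-ws′ p ⟩
    insertAfter i W (lookupL (setL ws q₀ []) p)     ≡⟨ cong (insertAfter i W) (lookup-setL-≢ ws q₀ p [] p≢q₀) ⟩
    insertAfter i W (lookupL ws p)                  ≡⟨ cong (insertAfter i W) p≡ ⟩
    insertAfter i W (as ++ i ∷ bs)                  ≡⟨ insertAfter-split i W as bs i∉as ⟩
    as ++ i ∷ W ++ bs                               ∎
    where open ≡-Reasoning

  lookup-source : lookupL ws′ q₀ ≡ []
  lookup-source rewrite lookup-ws′ q₀ | lookup-setL-≡ ws q₀ = refl

  lookup-other : ∀ q → q ≢ p → q ≢ q₀ → lookupL ws′ q ≡ lookupL ws q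
  lookup-other q q≢p q≢q₀ rewrite lookup-ws′ q | lookup-setL-≢ ws q₀ q [] q≢q₀ =
    insertAfter-∉ i W (lookupL ws q) (λ i∈q → q≢p (lookup-unique ws uniq i∈q i∈p))

  ∈-target⁻ : ∀ {y} → y ∈ lookupL ws′ p → y ∈ lookupL ws p ⊎ y ∈ W
  ∈-target⁻ {y} y∈ with ∈-++⁻ (as ++ i ∷ bs) (↭.∈-resp-↭ (insert-↭ as i W bs) (subst (y ∈_) lookup-target y∈))
  ... | inj₁ y∈p = inj₁ (subst (y ∈_) (sym p≡) y∈p)
  ... | inj₂ y∈W = inj₂ y∈W

  lookup-ws′-∷ : ∀ q {a w} → q ≢ q₀ → lookupL ws q ≡ a ∷ w → ∃ λ w′ → lookupL ws′ q ≡ a ∷ w′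
  lookup-ws′-∷ q {a} {w} q≢q₀ e rewrite lookup-ws′ q | lookup-setL-≢ ws q₀ q [] q≢q₀ | e = insertAfter-∷ i W a w

  concat-ws′-↭ : concat ws′ ↭ concat ws
  concat-ws′-↭ = ↭-trans (concat-map-insertAfter-↭ i (lookupL ws q₀) rest Unique-rest i∈rest)
                         (concat-setL-↭ ws q₀)
    where
    rest : List (List ℕ)
    rest = setL ws q₀ []
    Unique-rest : Unique (concat rest)
    Unique-rest = Unique-++⁻ˡ (concat rest) (Unique-resp-↭ (↭-sym (concat-setL-↭ ws q₀)) uniq)
    i∈rest : i ∈ concat rest
    i∈rest with ∈-++⁻ (concat rest) (↭.∈-resp-↭ (↭-sym (concat-setL-↭ ws q₀)) i∈)
    ... | inj₁ i∈′ = i∈′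
    ... | inj₂ i∈W = ⊥-elim (i∉W (subst (i ∈_) W≡ i∈W))

  Unique-ws′ : Unique (concat ws′)
  Unique-ws′ = Unique-resp-↭ (↭-sym concat-ws′-↭) uniq

  Last-target⁻ : ∀ {l} → Last (as ++ i ∷ W ++ bs) l →
                 (Last (as ++ i ∷ bs) l × l ≢ i) ⊎ (l ≡ x × Last (as ++ i ∷ bs) i)
  Last-target⁻ l′ with Last-split as l′
  ... | inj₂ (() , _)
  ... | inj₁ l with Last-++⁻ W l
  ...   | inj₁ l-bs         = inj₁ (Last-++ʳ as (last-there l-bs) , λ { refl → i∉bs (Last-∈ l-bs) })
  ...   | inj₂ (bs≡[] , l-W) =
    inj₂ (Last-unique l-W W-ends-with-x , subst (λ v → Last (as ++ i ∷ v) i) (sym bs≡[]) (Last-++ʳ as last-here))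

  Last-target⁺ : ∀ {l} → Last (as ++ i ∷ bs) l → l ≢ i → Last (as ++ i ∷ W ++ bs) l
  Last-target⁺ l l≢i with Last-split as l
  ... | inj₁ l-bs      = Last-++ʳ as (last-there (Last-++ʳ W l-bs))
  ... | inj₂ (_ , l≡i) = ⊥-elim (l≢i l≡i)

  Last-target-x : Last (as ++ i ∷ bs) i → Last (as ++ i ∷ W ++ bs) x
  Last-target-x l with Last-split as l
  ... | inj₁ l-bs       = ⊥-elim (i∉bs (Last-∈ l-bs))
  ... | inj₂ (bs≡[] , _) =
    subst (λ v → Last (as ++ i ∷ W ++ v) x) (sym bs≡[])
          (Last-++ʳ as (last-there (subst (λ v → Last v x) (sym (++-identityʳ W)) W-ends-with-x)))

  Last-preserved : ∀ q {l} → q ≢ q₀ → l ≢ i → Last (lookupL ws q) l → Last (lookupL ws′ q) l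
  Last-preserved q {l} q≢q₀ l≢i ll with q ≟ p
  ... | yes refl = subst (λ v → Last v l) (sym lookup-target) (Last-target⁺ (subst (λ v → Last v l) p≡ ll) l≢i)
  ... | no q≢p   = subst (λ v → Last v l) (sym (lookup-other q q≢p q≢q₀)) ll

  Successor-preserved : ∀ {y z} → y ≢ i → y ≢ x → Successor ws y z → Successor ws′ y z
  Successor-preserved {y} {z} y≢i y≢x (q , c) with q ≟ q₀
  ... | yes refl with subst (λ w → CyclicSucc w y z) W≡ c
  ... | inj₂ (l , _) = ⊥-elim (y≢x (Last-unique l W-ends-with-x))
  ... | inj₁ a = p , subst (λ w → CyclicSucc w y z) (sym lookup-target)
                           (inj₁ (Adjacent-++ʳ as (adj-there (Adjacent-++ˡ bs a))))
  Successor-preserved {y} {z} y≢i y≢x (q , c) | no q≢q₀ with q ≟ p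
  ... | yes refl with subst (λ w → CyclicSucc w y z) p≡ c
  ... | inj₁ a           = p , subst (λ w → CyclicSucc w y z) (sym lookup-target)
                                     (inj₁ (Adjacent-insert as y≢i a))
  ... | inj₂ (l , _ , e) = p , subst (λ w → CyclicSucc w y z) (sym lookup-target)
                                     (inj₂ (Last-target⁺ l y≢i , head-insert as e))
  Successor-preserved {y} {z} y≢i y≢x (q , c) | no q≢q₀ | no q≢p =
    q , subst (λ w → CyclicSucc w y z) (sym (lookup-other q q≢p q≢q₀)) c

  Successor-i : Successor ws′ i b₀
  Successor-i = p , subst (λ w → CyclicSucc w i b₀) (sym lookup-target) (inj₁ (Adjacent-++ʳ as adj-here))

  Successor-x : ∀ {s} → Successor ws i s → Successor ws′ x s
  Successor-x {s} (q , c) with lookup-unique ws uniq (CyclicSucc-∈ c) i∈p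
  ... | refl with subst (λ w → CyclicSucc w i s) p≡ c
  ... | inj₁ a with Adjacent-after as i∉as i∉bs a
  ... | bs′ , bs≡ =
    p , subst (λ w → CyclicSucc w x s) (sym lookup-target)
              (inj₁ (Adjacent-++ʳ as (adj-there (subst (λ v → Adjacent (W ++ v) x s) (sym bs≡)
                                                       (Last⇒Adjacent-++ s bs′ W-ends-with-x)))))
  Successor-x {s} (q , c) | refl | inj₂ (l , _ , e) =
    p , subst (λ w → CyclicSucc w x s) (sym lookup-target) (inj₂ (Last-target-x l , head-insert as e))

  applyWords-preserved : ∀ {y} → y ∈ concat ws → y ≢ i → y ≢ x → applyWords ws′ y ≡ applyWords ws y
  applyWords-preserved y∈ y≢i y≢x =
    applyWords-Successor ws′ Unique-ws′ (Successor-preserved y≢i y≢x (Successor-applyWords ws uniq y∈))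

  applyWords-i : applyWords ws′ i ≡ b₀
  applyWords-i = applyWords-Successor ws′ Unique-ws′ Successor-i

  applyWords-x : applyWords ws′ x ≡ applyWords ws i
  applyWords-x = applyWords-Successor ws′ Unique-ws′ (Successor-x (Successor-applyWords ws uniq i∈))

-- The invariant of the β-loop

module Partition {n : ℕ} {ws : List (List ℕ)} (partition : concat ws ↭ map suc (upTo n)) where

  unique : Unique (concat ws)
  unique = Unique-resp-↭ (↭-sym partition) (Unique-range n)

  range : ∀ {y} → y ∈ concat ws → 1 ≤ y × y ≤ n
  range y∈ = ∈-range⁻ (↭.∈-resp-↭ partition y∈)

  ∈-concat : ∀ {y} → 1 ≤ y → y ≤ n → y ∈ concat ws
  ∈-concat 1≤y y≤n = ↭.∈-resp-↭ (↭-sym partition) (∈-range⁺ 1≤y y≤n)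

NotLastBefore : ℕ → List (List ℕ) → ℕ → Set
NotLastBefore i ws y = ∀ q → q < i → ¬ Last (lookupL ws q) y

-- ws is the state of β before the steps i, i-1, …, 2; slot q started as the (q+1)-st cycle.
record Invariant (n k i : ℕ) (ws : List (List ℕ)) : Set where
  field
    partition        : concat ws ↭ map suc (upTo n)
    slot-bound       : ∀ q {y} → y ∈ lookupL ws q → suc q ≤ y
    nonempty         : ∀ q → q < i → ∃₂ λ a w → lookupL ws q ≡ a ∷ w
    first-ends-in-1  : Last (lookupL ws 0) 1
    last-letters     : ∀ q {l} → q < i → Last (lookupL ws q) l → k < l ⊎ l ≤ i
    exceedance-above : ∀ y → i < y → y ≤ n → NotLastBefore i ws y → (y ≤ applyWords ws y ⇔ y ≤ k)
    descent-below    : ∀ y → 2 ≤ y → y ≤ i → NotLastBefore i ws y → applyWords ws y < y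

  open Partition {n} {ws} partition public

  last-maps-up : ∀ q {y} → q < i → Last (lookupL ws q) y → suc q ≤ applyWords ws y
  last-maps-up q {y} q<i l with nonempty q q<i
  ... | a , w , e = subst (suc q ≤_) (sym σy≡a) (slot-bound q (subst (a ∈_) (sym e) (here refl)))
    where
    σy≡a : applyWords ws y ≡ a
    σy≡a = applyWords-Successor ws unique
             (q , subst (λ v → CyclicSucc v y a) (sym e) (inj₂ (subst (λ v → Last v y) e l , w , refl)))

last-bound-pred : ∀ {k l j} → k < l ⊎ l ≤ suc j → l ≢ suc j → k < l ⊎ l ≤ j
last-bound-pred (inj₁ k<l) _   = inj₁ k<l
last-bound-pred (inj₂ l≤i) l≢i = inj₂ (≤-pred (≤∧≢⇒< l≤i l≢i))

module KeepStep {n k : ℕ} (j : ℕ) (ws : List (List ℕ)) (1≤j : 1 ≤ j) (i≤k : suc j ≤ k)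
                (I : Invariant n k (suc j) ws) (i∈W : suc j ∈ lookupL ws j) where
  open Invariant I

  i : ℕ
  i = suc j

  i-not-last-elsewhere : ∀ q → q ≢ j → ¬ Last (lookupL ws q) i
  i-not-last-elsewhere q q≢j l = q≢j (lookup-unique ws unique (Last-∈ l) i∈W)

  -- i is the least letter of slot j, so the descent property leaves it no successor there.
  i-ends-slot-j : Last (lookupL ws j) i
  i-ends-slot-j with ∈⇒Last⊎Adjacent i∈W
  ... | inj₁ l       = l
  ... | inj₂ (z , a) = ⊥-elim (<⇒≱ z<i (slot-bound j (Adjacent-∈ʳ a)))
    where
    i-not-last : NotLastBefore i ws i
    i-not-last q _ l with q ≟ j
    ... | yes refl = Adjacent⇒¬Last (Unique-lookup ws j unique) a l
    ... | no q≢j   = i-not-last-elsewhere q q≢j l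
    z<i : z < i
    z<i = subst (_< i) (applyWords-Successor ws unique (j , inj₁ a)) (descent-below i (s≤s 1≤j) ≤-refl i-not-last)

  not-last-extend : ∀ {y} → y ≢ i → NotLastBefore j ws y → NotLastBefore i ws y
  not-last-extend y≢i hyp q q<i l with q ≟ j
  ... | yes refl = y≢i (Last-unique l i-ends-slot-j)
  ... | no q≢j   = hyp q (≤∧≢⇒< (≤-pred q<i) q≢j) l

  last-letters′ : ∀ q {l} → q < j → Last (lookupL ws q) l → k < l ⊎ l ≤ j
  last-letters′ q q<j l =
    last-bound-pred (last-letters q (m<n⇒m<1+n q<j) l) (λ { refl → i-not-last-elsewhere q (<⇒≢ q<j) l })

  exceedance-above′ : ∀ y → j < y → y ≤ n → NotLastBefore j ws y → (y ≤ applyWords ws y ⇔ y ≤ k)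
  exceedance-above′ y j<y y≤n hyp with y ≟ i
  ... | yes refl = mk⇔ (λ _ → i≤k) (λ _ → last-maps-up j ≤-refl i-ends-slot-j)
  ... | no y≢i   = exceedance-above y (≤∧≢⇒< j<y (≢-sym y≢i)) y≤n (not-last-extend y≢i hyp)

  descent-below′ : ∀ y → 2 ≤ y → y ≤ j → NotLastBefore j ws y → applyWords ws y < y
  descent-below′ y 2≤y y≤j hyp = descent-below y 2≤y (m≤n⇒m≤1+n y≤j) (not-last-extend y≢i hyp)
    where
    y≢i : y ≢ i
    y≢i refl = 1+n≰n y≤j

  invariant : Invariant n k j ws
  invariant = record
    { partition        = partition
    ; slot-bound       = slot-bound
    ; nonempty         = λ q q<j → nonempty q (m<n⇒m<1+n q<j)
    ; first-ends-in-1  = first-ends-in-1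
    ; last-letters     = last-letters′
    ; exceedance-above = exceedance-above′
    ; descent-below    = descent-below′
    }

module MoveStep {n k : ℕ} (j : ℕ) (ws : List (List ℕ)) (1≤j : 1 ≤ j) (i≤k : suc j ≤ k)
                (I : Invariant n k (suc j) ws) (i∉W : suc j ∉ lookupL ws j) where
  open Invariant I

  i : ℕ
  i = suc j

  head-W : ℕ
  head-W = proj₁ (nonempty j ≤-refl)

  W≡ : lookupL ws j ≡ head-W ∷ proj₁ (proj₂ (nonempty j ≤-refl))
  W≡ = proj₂ (proj₂ (nonempty j ≤-refl))

  head-W∈ : head-W ∈ lookupL ws j
  head-W∈ = subst (head-W ∈_) (sym W≡) (here refl)

  i∈ : i ∈ concat ws
  i∈ = ∈-concat (s≤s z≤n) (≤-trans (slot-bound j head-W∈) (proj₂ (range (lookup-∈-concat ws j head-W∈))))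

  open MoveBlock ws j i unique W≡ (λ i∈W → i∉W (subst (i ∈_) (sym W≡) i∈W)) i∈

  p<j : p < j
  p<j = ≤∧≢⇒< (≤-pred (slot-bound p i∈p)) p≢q₀

  x∈W : x ∈ lookupL ws j
  x∈W = subst (x ∈_) (sym W≡) (Last-∈ W-ends-with-x)

  i<x : i < x
  i<x = ≤∧≢⇒< (slot-bound j x∈W) (λ i≡x → i∉W (subst (_∈ lookupL ws j) (sym i≡x) x∈W))

  x≤n : x ≤ n
  x≤n = proj₂ (range (lookup-∈-concat ws j x∈W))

  k<x : k < x
  k<x with last-letters j ≤-refl (subst (λ v → Last v x) (sym W≡) W-ends-with-x)
  ... | inj₁ k<x = k<x
  ... | inj₂ x≤i = ⊥-elim (<⇒≱ i<x x≤i)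

  slot-bound′ : ∀ q {y} → y ∈ lookupL ws′ q → suc q ≤ y
  slot-bound′ q {y} y∈ with q ≟ p
  ... | yes refl with ∈-target⁻ y∈
  ... | inj₁ y∈p = slot-bound p y∈p
  ... | inj₂ y∈W = ≤-trans (s≤s (<⇒≤ p<j)) (slot-bound j (subst (y ∈_) (sym W≡) y∈W))
  slot-bound′ q {y} y∈ | no q≢p with q ≟ j
  ... | yes refl with subst (y ∈_) lookup-source y∈
  ... | ()
  slot-bound′ q {y} y∈ | no q≢p | no q≢j = slot-bound q (subst (y ∈_) (lookup-other q q≢p q≢j) y∈)

  nonempty′ : ∀ q → q < j → ∃₂ λ a w → lookupL ws′ q ≡ a ∷ w
  nonempty′ q q<j =
    let a , w , e = nonempty q (m<n⇒m<1+n q<j)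
        w′ , e′   = lookup-ws′-∷ q (<⇒≢ q<j) e
    in a , w′ , e′

  last-letters′ : ∀ q {l} → q < j → Last (lookupL ws′ q) l → k < l ⊎ l ≤ j
  last-letters′ q {l} q<j ll with q ≟ p
  ... | yes refl with Last-target⁻ (subst (λ v → Last v l) lookup-target ll)
  ... | inj₂ (refl , _)  = inj₁ k<x
  ... | inj₁ (lp , l≢i) =
    last-bound-pred (last-letters p (m<n⇒m<1+n p<j) (subst (λ v → Last v l) (sym p≡) lp)) l≢i
  last-letters′ q {l} q<j ll | no q≢p =
    last-bound-pred (last-letters q (m<n⇒m<1+n q<j) lq) (λ { refl → q≢p (lookup-unique ws unique (Last-∈ lq) i∈p) })
    where
    lq : Last (lookupL ws q) l
    lq = subst (λ v → Last v l) (lookup-other q q≢p (<⇒≢ q<j)) ll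

  not-last-before : ∀ {y} → y ≢ i → y ≢ x → NotLastBefore j ws′ y → NotLastBefore i ws y
  not-last-before y≢i y≢x hyp q q<i l with q ≟ j
  ... | yes refl = y≢x (Last-unique (subst (λ v → Last v _) W≡ l) W-ends-with-x)
  ... | no q≢j   = hyp q (≤∧≢⇒< (≤-pred q<i) q≢j) (Last-preserved q q≢j y≢i l)

  σi<i : NotLastBefore j ws′ x → applyWords ws i < i
  σi<i hyp with ∈⇒Last⊎Adjacent (subst (i ∈_) p≡ i∈p)
  ... | inj₁ l = ⊥-elim (hyp p p<j (subst (λ v → Last v x) (sym lookup-target) (Last-target-x l)))
  ... | inj₂ (_ , a) = descent-below i (s≤s 1≤j) ≤-refl i-not-last
    where
    i-not-last : NotLastBefore i ws i
    i-not-last q _ l with q ≟ p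
    ... | yes refl = Adjacent⇒¬Last Unique-p a (subst (λ v → Last v i) p≡ l)
    ... | no q≢p   = q≢p (lookup-unique ws unique (Last-∈ l) i∈p)

  exceedance-above′ : ∀ y → j < y → y ≤ n → NotLastBefore j ws′ y → (y ≤ applyWords ws′ y ⇔ y ≤ k)
  exceedance-above′ y j<y y≤n hyp with y ≟ i
  ... | yes refl = mk⇔ (λ _ → i≤k) (λ _ → subst (i ≤_) (sym applyWords-i) (slot-bound j head-W∈))
  ... | no y≢i with y ≟ x
  ... | yes refl =
    mk⇔ (λ x≤σx → ⊥-elim (<⇒≱ (<-trans (σi<i hyp) i<x) (subst (x ≤_) applyWords-x x≤σx)))
        (λ x≤k → ⊥-elim (<⇒≱ k<x x≤k))
  ... | no y≢x =
    subst (λ t → y ≤ t ⇔ y ≤ k) (sym (applyWords-preserved y∈ y≢i y≢x))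
          (exceedance-above y i<y y≤n (not-last-before y≢i y≢x hyp))
    where
    i<y : i < y
    i<y = ≤∧≢⇒< j<y (≢-sym y≢i)
    y∈ : y ∈ concat ws
    y∈ = ∈-concat (≤-trans (s≤s z≤n) (<⇒≤ i<y)) y≤n

  descent-below′ : ∀ y → 2 ≤ y → y ≤ j → NotLastBefore j ws′ y → applyWords ws′ y < y
  descent-below′ y 2≤y y≤j hyp =
    subst (_< y) (sym (applyWords-preserved y∈ y≢i y≢x))
          (descent-below y 2≤y (m≤n⇒m≤1+n y≤j) (not-last-before y≢i y≢x hyp))
    where
    y≢i : y ≢ i
    y≢i refl = 1+n≰n y≤j
    y≢x : y ≢ x
    y≢x refl = <⇒≱ (<-trans ≤-refl i<x) y≤j
    y∈ : y ∈ concat ws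
    y∈ = ∈-concat (≤-trans (s≤s z≤n) 2≤y) (≤-trans (m≤n⇒m≤1+n y≤j) (≤-trans (<⇒≤ i<x) x≤n))

  invariant : Invariant n k j ws′
  invariant = record
    { partition        = ↭-trans concat-ws′-↭ partition
    ; slot-bound       = slot-bound′
    ; nonempty         = nonempty′
    ; first-ends-in-1  = Last-preserved 0 (<⇒≢ 1≤j) (λ 1≡i → <⇒≢ 1≤j (suc-injective 1≡i)) first-ends-in-1
    ; last-letters     = last-letters′
    ; exceedance-above = exceedance-above′
    ; descent-below    = descent-below′
    }

-- The initial state

foldr-⊓-≤ : ∀ a w {y} → y ∈ a ∷ w → foldr _⊓_ a w ≤ y
foldr-⊓-≤ a []      (here refl)         = ≤-refl
foldr-⊓-≤ a (b ∷ w) (here refl)         = ≤-trans (m⊓n≤n b _) (foldr-⊓-≤ a w (here refl))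
foldr-⊓-≤ a (b ∷ w) (there (here refl)) = m⊓n≤m b _
foldr-⊓-≤ a (b ∷ w) (there (there y∈))  = ≤-trans (m⊓n≤n b _) (foldr-⊓-≤ a w (there y∈))

minL-≤ : ∀ {w y} → y ∈ w → minL w ≤ y
minL-≤ {a ∷ w} = foldr-⊓-≤ a w

minL-glb : ∀ {t} a w → (∀ {y} → y ∈ a ∷ w → t ≤ y) → t ≤ minL (a ∷ w)
minL-glb a []      t≤ = t≤ (here refl)
minL-glb a (b ∷ w) t≤ =
  ⊓-glb (t≤ (there (here refl))) (minL-glb a w λ { (here e) → t≤ (here e) ; (there y∈) → t≤ (there (there y∈)) })

minima-bound : ∀ C {t} → Linked (λ u v → minL u < minL v) C → t ≤ minL (lookupL C 0) →
               ∀ q {y} → y ∈ lookupL C q → t + q ≤ y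
minima-bound (w ∷ C)     {t} _        t≤ zero    {y} y∈ = subst (_≤ y) (sym (+-identityʳ t)) (≤-trans t≤ (minL-≤ y∈))
minima-bound (w ∷ v ∷ C) {t} (r ∷ lk) t≤ (suc q) {y} y∈ =
  subst (_≤ y) (sym (+-suc t q)) (minima-bound (v ∷ C) lk (≤-<-trans t≤ r) q y∈)

≤-from-predecessors : ∀ {k n} → (∀ q → q < k → suc q ≤ n) → k ≤ n
≤-from-predecessors {zero}  _ = z≤n
≤-from-predecessors {suc k} h = h k ≤-refl

module Initial {n : ℕ} (C : List (List ℕ)) (bp : IsBP1Words n C) (1≤n : 1 ≤ n) where

  k : ℕ
  k = length C

  open Partition {n} {C} (proj₂ (proj₂ bp))

  shape : ∀ q → q < k → (lookupL C q ≢ []) × Linked _>_ (lookupL C q)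
  shape q = All-lookupL C q (proj₁ bp)

  nonempty : ∀ q → q < k → ∃₂ λ a w → lookupL C q ≡ a ∷ w
  nonempty q q<k with lookupL C q | proj₁ (shape q q<k)
  ... | []    | ≢[] = ⊥-elim (≢[] refl)
  ... | a ∷ w | _   = a , w , refl

  1∈ : ∃ λ q → 1 ∈ lookupL C q
  1∈ = ∈-concat⇒lookup C (∈-concat ≤-refl 1≤n)

  0<k : 0 < k
  0<k = ≤-trans (s≤s z≤n) (lookup-<-length C _ (proj₂ 1∈))

  slot-bound : ∀ q {y} → y ∈ lookupL C q → suc q ≤ y
  slot-bound = minima-bound C (proj₁ (proj₂ bp)) 1≤min₀
    where
    1≤min₀ : 1 ≤ minL (lookupL C 0)
    1≤min₀ with nonempty 0 0<k
    ... | a , w , e = subst (λ v → 1 ≤ minL v) (sym e)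
                        (minL-glb a w (λ y∈ → proj₁ (range (lookup-∈-concat C 0 (subst (_ ∈_) (sym e) y∈)))))

  first-ends-in-1 : Last (lookupL C 0) 1
  first-ends-in-1 with nonempty 0 0<k
  ... | a , w , e with Last-exists a w
  ... | l , ends = subst (Last (lookupL C 0)) l≡1 ends′
    where
    ends′ : Last (lookupL C 0) l
    ends′ = subst (λ v → Last v l) (sym e) ends
    1∈slot₀ : 1 ∈ lookupL C 0
    1∈slot₀ = subst (λ q → 1 ∈ lookupL C q) (n≤0⇒n≡0 (≤-pred (slot-bound _ (proj₂ 1∈)))) (proj₂ 1∈)
    l≡1 : l ≡ 1
    l≡1 = ≤-antisym (Last-minimal (proj₂ (shape 0 0<k)) ends′ 1∈slot₀) (slot-bound 0 (Last-∈ ends′))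

  k≤n : k ≤ n
  k≤n = ≤-from-predecessors λ q q<k →
    let a , w , e = nonempty q q<k
        a∈ = subst (a ∈_) (sym e) (here refl)
    in ≤-trans (slot-bound q a∈) (proj₂ (range (lookup-∈-concat C q a∈)))

  descends : ∀ {y} → y ∈ concat C → NotLastBefore k C y → applyWords C y < y
  descends y∈ hyp with ∈-concat⇒lookup C y∈
  ... | q , y∈q with ∈⇒Last⊎Adjacent y∈q
  ... | inj₁ l       = ⊥-elim (hyp q (lookup-<-length C q y∈q) l)
  ... | inj₂ (_ , a) rewrite applyWords-Successor C unique (q , inj₁ a) =
    Adjacent-descending (proj₂ (shape q (lookup-<-length C q y∈q))) a

  last-letters : ∀ q {l} → q < k → Last (lookupL C q) l → k < l ⊎ l ≤ k
  last-letters _ {l} _ _ with l ≤? k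
  ... | yes l≤k = inj₂ l≤k
  ... | no  l≰k = inj₁ (≰⇒> l≰k)

  exceedance-above : ∀ y → k < y → y ≤ n → NotLastBefore k C y → (y ≤ applyWords C y ⇔ y ≤ k)
  exceedance-above y k<y y≤n hyp =
    mk⇔ (λ y≤σy → ⊥-elim (<⇒≱ (descends (∈-concat (≤-trans (s≤s z≤n) k<y) y≤n) hyp) y≤σy))
        (λ y≤k → ⊥-elim (<⇒≱ k<y y≤k))

  descent-below : ∀ y → 2 ≤ y → y ≤ k → NotLastBefore k C y → applyWords C y < y
  descent-below y 2≤y y≤k = descends (∈-concat (≤-trans (s≤s z≤n) 2≤y) (≤-trans y≤k k≤n))

  invariant : Invariant n k k C
  invariant = record
    { partition        = proj₂ (proj₂ bp)
    ; slot-bound       = slot-bound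
    ; nonempty         = nonempty
    ; first-ends-in-1  = first-ends-in-1
    ; last-letters     = last-letters
    ; exceedance-above = exceedance-above
    ; descent-below    = descent-below
    }

Invariant-step : ∀ {n k} j ws → suc (suc j) ≤ k → Invariant n k (suc (suc j)) ws →
                 Invariant n k (suc j) (βstep (suc (suc j)) ws)
Invariant-step j ws i≤k I with suc (suc j) ∈? lookupL ws (suc j)
... | yes i∈W = KeepStep.invariant (suc j) ws (s≤s z≤n) i≤k I i∈W
... | no  i∉W = MoveStep.invariant (suc j) ws (s≤s z≤n) i≤k I i∉W

Invariant-βloop : ∀ {n k} m ws → 1 ≤ m → m ≤ k → Invariant n k m ws → Invariant n k 1 (βloop m ws)
Invariant-βloop (suc zero)    ws _ _   I = I
Invariant-βloop (suc (suc j)) ws _ m≤k I =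
  Invariant-βloop (suc j) (βstep (suc (suc j)) ws) (s≤s z≤n) (≤-trans (n≤1+n _) m≤k) (Invariant-step j ws m≤k I)

Invariant-β : ∀ {n} C → IsBP1Words n C → 1 ≤ n → 0 < length C × Invariant n (length C) 1 (β C)
Invariant-β C bp 1≤n = 0<k , Invariant-βloop (length C) C 0<k ≤-refl invariant
  where open Initial C bp 1≤n

Invariant-1⇒weak-exceedances : ∀ {n k ws} → 0 < k → Invariant n k 1 ws →
                               ∀ y → 1 ≤ y → y ≤ n → (y ≤ applyWords ws y ⇔ y ≤ k)
Invariant-1⇒weak-exceedances {ws = ws} 0<k I y 1≤y y≤n with y ≟ 1
... | yes refl = mk⇔ (λ _ → 0<k) (λ _ → last-maps-up 0 ≤-refl first-ends-in-1)
  where open Invariant I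
... | no y≢1   = exceedance-above y (≤∧≢⇒< 1≤y (≢-sym y≢1)) y≤n y-not-last
  where
  open Invariant I
  y-not-last : NotLastBefore 1 ws y
  y-not-last zero _ l = y≢1 (Last-unique l first-ends-in-1)
  y-not-last (suc _) (s≤s ()) _

mainTheorem9 : (n : ℕ) (C : List (List ℕ)) → IsBP1Words n C →
    (i : ℕ) → 1 ≤ i → i ≤ n → ((i ≤ applyWords (β C) i) ⇔ (i ≤ length C))
mainTheorem9 n C bp i 1≤i i≤n =
  let 0<k , I = Invariant-β C bp (≤-trans 1≤i i≤n)
  in Invariant-1⇒weak-exceedances 0<k I i 1≤i i≤n
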